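{- Let $w=w[0..n-1]$ be a word of length $n\geq 1$ over a finite ordered alphabet $\Sigma=\{a_1,\ldots,a_\sigma\}$, and let $p$ be a positive divisor of $n$. Then $w$ has full Abelian period $p$ if and only if for every $k=0,1,\ldots,n/p-1$, the position $k\times p$ is the starting position of a scaled suffix of $w$ (i.e., $w[kp..n-1]$ is scaled).
   Context: For a word $u$ over $\Sigma$, its Parikh vector is $\mathcal{P}_u=(|u|_{a_1},\ldots,|u|_{a_\sigma})$, where $|u|_a$ is the number of occurrences of the letter $a$ in $u$. A positive integer $p$ is a full Abelian period of $w$ if $w=u_1u_2\cdots u_m$ with $m\geq1$, $|u_i|=p$ for all $i$, and $\mathcal{P}_{u_1}=\cdots=\mathcal{P}_{u_m}$. Let $g$ be the greatest common divisor of the entries of $\mathcal{P}_w$ and $s=n/g$. A factor $u$ of $w$ is called scaled if there exists a real number $k\geq 0$ such that $\mathcal{P}_u=k\times\mathcal{P}_w/s$.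
   Formalization: The scaling factor k in the definition of a scaled factor ranges over the nonnegative rationals rather than the nonnegative reals. -}

module Defs where

open import Data.Nat using (ℕ; zero; suc; NonZero)
open import Data.Nat.DivMod using () renaming (_/_ to _div_)
open import Data.Nat.GCD using (gcd)
open import Data.Fin using (Fin; _≟_)
open import Data.List using (List; []; length; filter; foldr; concat; map)
open import Data.List.Relation.Unary.All using (All)
open import Data.Vec using (Vec; tabulate; toList)
open import Data.Integer using (+_)
open import Data.Rational using (ℚ; _*_; _/_; _≤_; 0ℚ)
open import Data.Product using (Σ; _×_)
open import Relation.Binary.PropositionalEquality using (_≡_; _≢_)

occ : ∀ {σ} → Fin σ → List (Fin σ) → ℕ
occ a u = length (filter (_≟ a) u)

parikh : ∀ {σ} → List (Fin σ) → Vec ℕ σ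
parikh u = tabulate (λ a → occ a u)

FullAbelianPeriod : ∀ {σ} → List (Fin σ) → ℕ → Set
FullAbelianPeriod {σ} w p =
  Σ (List (List (Fin σ))) λ us →
    (us ≢ []) × (concat us ≡ w) × All (λ u → length u ≡ p) us ×
    Σ (Vec ℕ σ) λ P → All (λ u → parikh u ≡ P) us

gcdParikh : ∀ {σ} → List (Fin σ) → ℕ
gcdParikh w = foldr gcd 0 (toList (parikh w))

-- natural division, with the (never used) convention n / 0 = 0
divNat : ℕ → ℕ → ℕ
divNat n zero = 0
divNat n (suc g) = n div (suc g)

sParam : ∀ {σ} → List (Fin σ) → ℕ
sParam w = divNat (length w) (gcdParikh w)

ℕtoℚ : ℕ → ℚ
ℕtoℚ n = (+ n) / 1

-- u is scaled (w.r.t. w): ∃ k ≥ 0 with P_u = k × P_w / s, i.e. s·|u|_a = k·|w|_a for all a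
-- (k ranges over ℚ)
Scaled : ∀ {σ} → List (Fin σ) → List (Fin σ) → Set
Scaled {σ} w u =
  Σ ℚ λ k → (0ℚ ≤ k) ×
    ((a : Fin σ) → ℕtoℚ (sParam w) * ℕtoℚ (occ a u) ≡ k * ℕtoℚ (occ a w))

module Submission where

-- The proof passes through a division-free notion: u is *proportional* to w when
-- |w|·|u|_a = |u|·|w|_a for every letter a.

open import Defs
open import Data.Nat using (ℕ; zero; suc; pred; _+_; _*_; _∸_; _⊓_; _<_; _≤_; z≤n; s≤s; NonZero; >-nonZero; ≢-nonZero)
open import Data.Nat.Properties
  using ( +-*-semiring; *-zeroʳ; *-identityʳ; *-comm; *-assoc; *-distribˡ-+; *-distribʳ-+
        ; +-cancelʳ-≡; *-cancelˡ-≡; m≤m+n; m≤n⇒m⊓n≡m; m+n∸m≡n; m<n⇒n≢0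
        ; m≤n⇒m<n∨m≡n; ≤-reflexive; suc-pred )
open import Data.Nat.Tactic.RingSolver using (solve-∀)
open import Data.Nat.DivMod using (_/_; m/n*n≡m; m*n/n≡m)
open import Data.Nat.Divisibility using (_∣_; divides; ∣-trans; _∣0; ∣m∣n⇒∣m+n; 0∣⇒≡0)
open import Data.Nat.GCD using (gcd; gcd[m,n]∣m; gcd[m,n]∣n)
open import Data.Fin using (Fin; _≟_) renaming (zero to fzero; suc to fsuc)
open import Data.List using (List; []; _∷_; [_]; length; foldr; concat; _++_; take; drop)
open import Data.List.Properties
  using (length-++; length-take; length-drop; take++drop≡id; drop-drop; drop-[]; drop-all)
open import Data.List.Relation.Unary.All as All using (All; []; _∷_)
open import Data.List.Relation.Unary.All.Properties using (drop⁺)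
open import Data.Vec using (tabulate; toList; lookup)
open import Data.Vec.Properties using (lookup∘tabulate; tabulate-cong)
open import Data.Bool using (true; false)
open import Data.Integer using (+_)
open import Data.Integer.Properties using (pos-*; +-injective)
open import Data.Rational using (ℚ; 0ℚ; fromℚᵘ) renaming (_*_ to _ℚ*_; _≤_ to _ℚ≤_)
open import Data.Rational.Properties
  using (fromℚᵘ-cong; fromℚᵘ-injective; toℚᵘ-injective; toℚᵘ-fromℚᵘ; toℚᵘ-homo-*;
         nonNegative⁻¹; normalize-nonNeg)
  renaming (*-assoc to ℚ*-assoc; *-comm to ℚ*-comm)
open import Data.Rational.Unnormalised using (mkℚᵘ; *≡*) renaming (_*_ to _ᵘ*_)
open import Data.Rational.Unnormalised.Properties using (≃-trans; ≃-sym; *-cong)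
open import Data.Sum using (inj₁; inj₂)
open import Data.Product using (_×_; _,_)
open import Function using (_∘_)
open import Function.Bundles using (_⇔_; mk⇔)
open import Relation.Nullary using (yes; no; does; contradiction)
open import Relation.Binary.PropositionalEquality
  using (_≡_; _≢_; refl; sym; trans; cong; cong₂; subst; module ≡-Reasoning)

open import Algebra.Properties.Semiring.Sum +-*-semiring
  using (sum; sum-cong-≗; sum-replicate-zero; ∑-distrib-+; *-distribˡ-sum)

occ-++ : ∀ {σ} (a : Fin σ) (u v : List (Fin σ)) → occ a (u ++ v) ≡ occ a u + occ a v
occ-++ a []      v = refl
occ-++ a (x ∷ u) v with does (x ≟ a)
... | true  = cong suc (occ-++ a u v)
... | false = occ-++ a u v

occ-singleton-fsuc : ∀ {σ} (x a : Fin σ) → occ (fsuc a) [ fsuc x ] ≡ occ a [ x ]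
occ-singleton-fsuc x a with x ≟ a
... | yes _ = refl
... | no _  = refl

sum-occ-singleton : ∀ {σ} (x : Fin σ) → sum (λ a → occ a [ x ]) ≡ 1
sum-occ-singleton {suc σ} fzero    = cong suc (sum-replicate-zero σ)
sum-occ-singleton {suc σ} (fsuc x) =
  trans (sum-cong-≗ (occ-singleton-fsuc x)) (sum-occ-singleton x)

sum-occ : ∀ {σ} (u : List (Fin σ)) → sum (λ a → occ a u) ≡ length u
sum-occ {σ} []      = sum-replicate-zero σ
sum-occ     (x ∷ u) = begin
  sum (λ a → occ a (x ∷ u))                         ≡⟨ sum-cong-≗ (λ a → occ-++ a [ x ] u) ⟩
  sum (λ a → occ a [ x ] + occ a u)                 ≡⟨ ∑-distrib-+ (λ a → occ a [ x ]) (λ a → occ a u) ⟩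
  sum (λ a → occ a [ x ]) + sum (λ a → occ a u)     ≡⟨ cong₂ _+_ (sum-occ-singleton x) (sum-occ u) ⟩
  suc (length u)                                    ∎
  where open ≡-Reasoning

gcd-∣-sum : ∀ {σ} (f : Fin σ → ℕ) → foldr gcd 0 (toList (tabulate f)) ∣ sum f
gcd-∣-sum {zero}  f = 0 ∣0
gcd-∣-sum {suc σ} f =
  ∣m∣n⇒∣m+n (gcd[m,n]∣m (f fzero) _) (∣-trans (gcd[m,n]∣n (f fzero) _) (gcd-∣-sum (f ∘ fsuc)))

divNat-nonZero : ∀ n g → g ∣ n → n ≢ 0 → divNat n g ≢ 0
divNat-nonZero n zero    g∣n n≢0 _     = n≢0 (0∣⇒≡0 g∣n)
divNat-nonZero n (suc g) g∣n n≢0 n/g≡0 = n≢0 (trans (sym (m/n*n≡m g∣n)) (cong (_* suc g) n/g≡0))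

-- The parameter s = n / g of a nonempty word is nonzero, since g divides Σ_a |w|_a = n.
sParam-nonZero : ∀ {σ} (w : List (Fin σ)) → 0 < length w → sParam w ≢ 0
sParam-nonZero w |w|>0 =
  divNat-nonZero (length w) (gcdParikh w)
    (subst (gcdParikh w ∣_) (sum-occ w) (gcd-∣-sum (λ a → occ a w))) (m<n⇒n≢0 |w|>0)

-- u is proportional to w: P_u = (|u|/|w|)·P_w, stated without division.
Proportional : ∀ {σ} → List (Fin σ) → List (Fin σ) → Set
Proportional w u = ∀ a → length w * occ a u ≡ length u * occ a w

occ≡lookup-parikh : ∀ {σ} (a : Fin σ) (u : List (Fin σ)) → occ a u ≡ lookup (parikh u) a
occ≡lookup-parikh a u = sym (lookup∘tabulate (λ b → occ b u) a)

length-concat-uniform : ∀ {A : Set} p {vs : List (List A)} →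
  All (λ u → length u ≡ p) vs → length (concat vs) ≡ length vs * p
length-concat-uniform p []                   = refl
length-concat-uniform p {u ∷ vs} (|u|≡p ∷ ls) =
  trans (length-++ u) (cong₂ _+_ |u|≡p (length-concat-uniform p ls))

occ-concat-uniform : ∀ {σ} (a : Fin σ) P {vs : List (List (Fin σ))} →
  All (λ u → parikh u ≡ P) vs → occ a (concat vs) ≡ length vs * lookup P a
occ-concat-uniform a P []                     = refl
occ-concat-uniform a P {u ∷ vs} (P_u≡P ∷ ps) =
  trans (occ-++ a u (concat vs))
        (cong₂ _+_ (trans (occ≡lookup-parikh a u) (cong (λ V → lookup V a) P_u≡P))
                   (occ-concat-uniform a P ps))

uniform-proportional : ∀ {σ} p P {us vs : List (List (Fin σ))} →
  All (λ u → length u ≡ p) us → All (λ u → parikh u ≡ P) us →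
  All (λ v → length v ≡ p) vs → All (λ v → parikh v ≡ P) vs →
  Proportional (concat us) (concat vs)
uniform-proportional p P {us} {vs} lus pus lvs pvs a = begin
  length (concat us) * occ a (concat vs)
    ≡⟨ cong₂ _*_ (length-concat-uniform p lus) (occ-concat-uniform a P pvs) ⟩
  (length us * p) * (length vs * lookup P a)
    ≡⟨ exchange (length us) p (length vs) (lookup P a) ⟩
  (length vs * p) * (length us * lookup P a)
    ≡⟨ cong₂ _*_ (length-concat-uniform p lvs) (occ-concat-uniform a P pus) ⟨
  length (concat vs) * occ a (concat us) ∎
  where
  open ≡-Reasoning
  exchange : ∀ m p j x → (m * p) * (j * x) ≡ (j * p) * (m * x)
  exchange = solve-∀

proportional-prefix : ∀ {σ} (w u v : List (Fin σ)) →
  Proportional w (u ++ v) → Proportional w v → Proportional w u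
proportional-prefix w u v uv∝w v∝w a =
  +-cancelʳ-≡ (N * occ a v) (N * occ a u) (length u * occ a w) (begin
  N * occ a u + N * occ a v                   ≡⟨ *-distribˡ-+ N (occ a u) (occ a v) ⟨
  N * (occ a u + occ a v)                     ≡⟨ cong (N *_) (occ-++ a u v) ⟨
  N * occ a (u ++ v)                          ≡⟨ uv∝w a ⟩
  length (u ++ v) * occ a w                   ≡⟨ cong (_* occ a w) (length-++ u) ⟩
  (length u + length v) * occ a w             ≡⟨ *-distribʳ-+ (occ a w) (length u) (length v) ⟩
  length u * occ a w + length v * occ a w     ≡⟨ cong (λ z → length u * occ a w + z) (v∝w a) ⟨
  length u * occ a w + N * occ a v            ∎)
  where
  open ≡-Reasoning
  N : ℕ
  N = length w

proportional-parikh : ∀ {σ} (w u v : List (Fin σ)) → 0 < length w → length u ≡ length v →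
  Proportional w u → Proportional w v → parikh u ≡ parikh v
proportional-parikh w u v |w|>0 |u|≡|v| u∝w v∝w = tabulate-cong λ a →
  *-cancelˡ-≡ (occ a u) (occ a v) (length w) {{>-nonZero |w|>0}}
    (trans (u∝w a) (trans (cong (_* occ a w) |u|≡|v|) (sym (v∝w a))))

drop-length-++ : ∀ {A : Set} (u v : List A) → drop (length u) (u ++ v) ≡ v
drop-length-++ []      v = refl
drop-length-++ (x ∷ u) v = drop-length-++ u v

drop-concat-uniform : ∀ {A : Set} p k (us : List (List A)) →
  All (λ u → length u ≡ p) us → drop (k * p) (concat us) ≡ concat (drop k us)
drop-concat-uniform p zero    us       _           = refl
drop-concat-uniform p (suc k) []       _           = drop-[] (p + k * p)
drop-concat-uniform p (suc k) (u ∷ us) (refl ∷ ls) = begin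
  drop (length u + k * length u) (u ++ concat us)   ≡⟨ drop-drop (length u) (k * length u) _ ⟨
  drop (k * length u) (drop (length u) (u ++ concat us))
                                                    ≡⟨ cong (drop (k * length u)) (drop-length-++ u _) ⟩
  drop (k * length u) (concat us)                   ≡⟨ drop-concat-uniform (length u) k us ls ⟩
  concat (drop k us)                                ∎
  where open ≡-Reasoning

chunks : ∀ {A : Set} → ℕ → ℕ → List A → List (List A)
chunks p zero    v = []
chunks p (suc q) v = take p v ∷ chunks p q (drop p v)

length-take-block : ∀ {A : Set} p m (v : List A) → length v ≡ p + m → length (take p v) ≡ p
length-take-block p m v |v|≡ =
  trans (length-take p v) (trans (cong (p ⊓_) |v|≡) (m≤n⇒m⊓n≡m (m≤m+n p m)))

length-drop-block : ∀ {A : Set} p m (v : List A) → length v ≡ p + m → length (drop p v) ≡ m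
length-drop-block p m v |v|≡ = trans (length-drop p v) (trans (cong (_∸ p) |v|≡) (m+n∸m≡n p m))

concat-chunks : ∀ {A : Set} p q (v : List A) → length v ≡ q * p → concat (chunks p q v) ≡ v
concat-chunks p zero    []      _    = refl
concat-chunks p (suc q) v       |v|≡ =
  trans (cong (take p v ++_) (concat-chunks p q (drop p v) (length-drop-block p (q * p) v |v|≡)))
        (take++drop≡id p v)

chunks-length : ∀ {A : Set} p q (v : List A) → length v ≡ q * p →
  All (λ b → length b ≡ p) (chunks p q v)
chunks-length p zero    v _    = []
chunks-length p (suc q) v |v|≡ =
  length-take-block p (q * p) v |v|≡
  ∷ chunks-length p q (drop p v) (length-drop-block p (q * p) v |v|≡)

-- If the suffixes of v at the block boundaries 0, p, ..., q·p are proportional to w,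
-- so is every block, being the difference of two consecutive such suffixes.
chunks-proportional : ∀ {σ} (w : List (Fin σ)) p q (v : List (Fin σ)) →
  (∀ i → i ≤ q → Proportional w (drop (i * p) v)) → All (Proportional w) (chunks p q v)
chunks-proportional w p zero    v suffix∝w = []
chunks-proportional w p (suc q) v suffix∝w =
  proportional-prefix w (take p v) (drop p v)
    (subst (Proportional w) (sym (take++drop≡id p v)) (suffix∝w 0 z≤n)) (rest∝w 0 z≤n)
  ∷ chunks-proportional w p q (drop p v) rest∝w
  where
  rest∝w : ∀ i → i ≤ q → Proportional w (drop (i * p) (drop p v))
  rest∝w i i≤q =
    subst (Proportional w) (sym (drop-drop p (i * p) v)) (suffix∝w (suc i) (s≤s i≤q))

fromℚᵘ-homo-* : ∀ p q → fromℚᵘ (p ᵘ* q) ≡ fromℚᵘ p ℚ* fromℚᵘ q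
fromℚᵘ-homo-* p q = toℚᵘ-injective (≃-trans (toℚᵘ-fromℚᵘ (p ᵘ* q))
  (≃-sym (≃-trans (toℚᵘ-homo-* (fromℚᵘ p) (fromℚᵘ q))
                  (*-cong (toℚᵘ-fromℚᵘ p) (toℚᵘ-fromℚᵘ q)))))

-- The fraction m / (1 + d); note that ℕtoℚ m is definitionally frac m 0.
frac : ℕ → ℕ → ℚ
frac m d = fromℚᵘ (mkℚᵘ (+ m) d)

-- Fractions multiply numerator by numerator and denominator by denominator
-- ((1 + b)·(1 + d) = 1 + (d + b·(1 + d))).
frac-* : ∀ m b n d → frac m b ℚ* frac n d ≡ frac (m * n) (d + b * suc d)
frac-* m b n d = trans (sym (fromℚᵘ-homo-* (mkℚᵘ (+ m) b) (mkℚᵘ (+ n) d)))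
                       (cong (λ z → fromℚᵘ (mkℚᵘ z (d + b * suc d))) (sym (pos-* m n)))

frac-cong : ∀ m b n d → m * suc d ≡ n * suc b → frac m b ≡ frac n d
frac-cong m b n d eq =
  fromℚᵘ-cong {mkℚᵘ (+ m) b} {mkℚᵘ (+ n) d}
    (*≡* (trans (sym (pos-* m (suc d))) (trans (cong +_ eq) (pos-* n (suc b)))))

frac-injective : ∀ m b n d → frac m b ≡ frac n d → m * suc d ≡ n * suc b
frac-injective m b n d eq with fromℚᵘ-injective {mkℚᵘ (+ m) b} {mkℚᵘ (+ n) d} eq
... | *≡* cross = +-injective (trans (pos-* m (suc d)) (trans cross (sym (pos-* n (suc b)))))

frac-nonNeg : ∀ m d → 0ℚ ℚ≤ frac m d
frac-nonNeg m d = nonNegative⁻¹ _ {{normalize-nonNeg m (suc d)}}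

ℕtoℚ-* : ∀ m n → ℕtoℚ (m * n) ≡ ℕtoℚ m ℚ* ℕtoℚ n
ℕtoℚ-* m n = sym (frac-* m 0 n 0)

ℕtoℚ-injective : ∀ {m n} → ℕtoℚ m ≡ ℕtoℚ n → m ≡ n
ℕtoℚ-injective {m} {n} eq =
  trans (sym (*-identityʳ m)) (trans (frac-injective m 0 n 0 eq) (*-identityʳ n))

scaling-factor : ∀ s L d x y → suc d * x ≡ L * y →
  ℕtoℚ s ℚ* ℕtoℚ x ≡ frac (s * L) d ℚ* ℕtoℚ y
scaling-factor s L d x y eq = begin
  ℕtoℚ s ℚ* ℕtoℚ x           ≡⟨ ℕtoℚ-* s x ⟨
  frac (s * x) 0             ≡⟨ frac-cong (s * x) 0 (s * L * y) (d * 1) cross ⟩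
  frac (s * L * y) (d * 1)   ≡⟨ frac-* (s * L) d y 0 ⟨
  frac (s * L) d ℚ* ℕtoℚ y   ∎
  where
  open ≡-Reasoning
  cross : s * x * suc (d * 1) ≡ s * L * y * 1
  cross = begin
    s * x * suc (d * 1)  ≡⟨ regroupˡ s x d ⟩
    s * (suc d * x)      ≡⟨ cong (s *_) eq ⟩
    s * (L * y)          ≡⟨ regroupʳ s L y ⟩
    s * L * y * 1        ∎
    where
    regroupˡ : ∀ s x d → s * x * suc (d * 1) ≡ s * (suc d * x)
    regroupˡ = solve-∀
    regroupʳ : ∀ s L y → s * (L * y) ≡ s * L * y * 1
    regroupʳ = solve-∀

cross-multiply : ∀ s k x y x' y' → ℕtoℚ s ℚ* ℕtoℚ x ≡ k ℚ* ℕtoℚ y →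
  ℕtoℚ s ℚ* ℕtoℚ x' ≡ k ℚ* ℕtoℚ y' → s * x * y' ≡ s * x' * y
cross-multiply s k x y x' y' sx≡ky sx'≡ky' = ℕtoℚ-injective (begin
  ℕtoℚ (s * x * y')                  ≡⟨ embed s x y' ⟩
  (ℕtoℚ s ℚ* ℕtoℚ x) ℚ* ℕtoℚ y'      ≡⟨ cong (_ℚ* ℕtoℚ y') sx≡ky ⟩
  (k ℚ* ℕtoℚ y) ℚ* ℕtoℚ y'           ≡⟨ ℚ*-assoc k (ℕtoℚ y) (ℕtoℚ y') ⟩
  k ℚ* (ℕtoℚ y ℚ* ℕtoℚ y')           ≡⟨ cong (k ℚ*_) (ℚ*-comm (ℕtoℚ y) (ℕtoℚ y')) ⟩
  k ℚ* (ℕtoℚ y' ℚ* ℕtoℚ y)           ≡⟨ ℚ*-assoc k (ℕtoℚ y') (ℕtoℚ y) ⟨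
  (k ℚ* ℕtoℚ y') ℚ* ℕtoℚ y           ≡⟨ cong (_ℚ* ℕtoℚ y) sx'≡ky' ⟨
  (ℕtoℚ s ℚ* ℕtoℚ x') ℚ* ℕtoℚ y      ≡⟨ embed s x' y ⟨
  ℕtoℚ (s * x' * y)                  ∎)
  where
  open ≡-Reasoning
  embed : ∀ a b c → ℕtoℚ (a * b * c) ≡ (ℕtoℚ a ℚ* ℕtoℚ b) ℚ* ℕtoℚ c
  embed a b c = trans (ℕtoℚ-* (a * b) c) (cong (_ℚ* ℕtoℚ c) (ℕtoℚ-* a b))

-- A proportional factor u of a nonempty w is scaled, with k = s·|u| / |w|.
proportional⇒scaled : ∀ {σ} (w u : List (Fin σ)) → 0 < length w → Proportional w u → Scaled w u
proportional⇒scaled w u |w|>0 u∝w =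
  frac (sParam w * length u) d , frac-nonNeg (sParam w * length u) d , λ a →
    scaling-factor (sParam w) (length u) d (occ a u) (occ a w)
      (subst (λ n → n * occ a u ≡ length u * occ a w) |w|≡1+d (u∝w a))
  where
  d : ℕ
  d = pred (length w)
  |w|≡1+d : length w ≡ suc d
  |w|≡1+d = sym (suc-pred (length w) {{>-nonZero |w|>0}})

-- A scaled factor u of a nonempty w is proportional: cross-multiplying s·|u|_a = k·|w|_a
-- with s·|u|_b = k·|w|_b and cancelling s ≠ 0 gives |u|_a·|w|_b = |w|_a·|u|_b;
-- summing over b gives |u|_a·|w| = |w|_a·|u|.
scaled⇒proportional : ∀ {σ} (w u : List (Fin σ)) → 0 < length w → Scaled w u → Proportional w u
scaled⇒proportional w u |w|>0 (k , _ , s·P_u≡k·P_w) a = begin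
  length w * occ a u                        ≡⟨ *-comm (length w) (occ a u) ⟩
  occ a u * length w                        ≡⟨ cong (occ a u *_) (sum-occ w) ⟨
  occ a u * sum (λ b → occ b w)             ≡⟨ *-distribˡ-sum (occ a u) (λ b → occ b w) ⟩
  sum (λ b → occ a u * occ b w)             ≡⟨ sum-cong-≗ exchange ⟩
  sum (λ b → occ a w * occ b u)             ≡⟨ *-distribˡ-sum (occ a w) (λ b → occ b u) ⟨
  occ a w * sum (λ b → occ b u)             ≡⟨ cong (occ a w *_) (sum-occ u) ⟩
  occ a w * length u                        ≡⟨ *-comm (occ a w) (length u) ⟩
  length u * occ a w                        ∎
  where
  open ≡-Reasoning
  s : ℕ
  s = sParam w
  exchange : ∀ b → occ a u * occ b w ≡ occ a w * occ b u
  exchange b = *-cancelˡ-≡ (occ a u * occ b w) (occ a w * occ b u) s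
    {{≢-nonZero (sParam-nonZero w |w|>0)}} (begin
      s * (occ a u * occ b w)   ≡⟨ *-assoc s (occ a u) (occ b w) ⟨
      s * occ a u * occ b w     ≡⟨ cross-multiply s k (occ a u) (occ a w) (occ b u) (occ b w)
                                     (s·P_u≡k·P_w a) (s·P_u≡k·P_w b) ⟩
      s * occ b u * occ a w     ≡⟨ *-assoc s (occ b u) (occ a w) ⟩
      s * (occ b u * occ a w)   ≡⟨ cong (s *_) (*-comm (occ b u) (occ a w)) ⟩
      s * (occ a w * occ b u)   ∎)

-- If p is a full Abelian period of w, every suffix starting at a multiple of p
-- consists of whole blocks and is therefore proportional to w.
period⇒proportional-suffixes : ∀ {σ} {w : List (Fin σ)} {p} →
  FullAbelianPeriod w p → ∀ k → Proportional w (drop (k * p) w)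
period⇒proportional-suffixes {p = p} (us , _ , refl , lus , P , pus) k =
  subst (Proportional (concat us)) (sym (drop-concat-uniform p k us lus))
    (uniform-proportional p P lus pus (drop⁺ k lus) (drop⁺ k pus))

-- Conversely, if |w| = (1 + q)·p > 0 and the suffixes of w at all block boundaries are
-- proportional to w, then the blocks are proportional to w, so they share the Parikh
-- vector of the first block and witness the full Abelian period p.
proportional-suffixes⇒period : ∀ {σ} (w : List (Fin σ)) p q → 0 < length w →
  length w ≡ suc q * p → (∀ i → i ≤ suc q → Proportional w (drop (i * p) w)) →
  FullAbelianPeriod w p
proportional-suffixes⇒period {σ} w p q |w|>0 |w|≡ suffix∝w =
  blocks , (λ ()) , concat-chunks p (suc q) w |w|≡ , lengths ,
  parikh (take p w) , All.zipWith (λ {b} → same-parikh {b}) (lengths , proportions)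
  where
  blocks : List (List (Fin σ))
  blocks = chunks p (suc q) w
  lengths : All (λ b → length b ≡ p) blocks
  lengths = chunks-length p (suc q) w |w|≡
  proportions : All (Proportional w) blocks
  proportions = chunks-proportional w p (suc q) w suffix∝w
  same-parikh : ∀ {b} → length b ≡ p × Proportional w b → parikh b ≡ parikh (take p w)
  same-parikh {b} (|b|≡p , b∝w) =
    proportional-parikh w b (take p w) |w|>0 (trans |b|≡p (sym (All.head lengths)))
      b∝w (All.head proportions)

lemma2 : (σ : ℕ) (w : List (Fin σ)) (p : ℕ) .{{_ : NonZero p}} →
    1 ≤ length w → p ∣ length w →
    FullAbelianPeriod w p ⇔
      ((k : ℕ) → k < length w / p → Scaled w (drop (k * p) w))
lemma2 σ w p |w|>0 (divides zero |w|≡0)     = contradiction |w|≡0 (m<n⇒n≢0 |w|>0)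
lemma2 σ w p |w|>0 (divides (suc q) |w|≡) = mk⇔ to from
  where
  #blocks : length w / p ≡ suc q
  #blocks = trans (cong (_/ p) |w|≡) (m*n/n≡m (suc q) p)

  to : FullAbelianPeriod w p → ∀ k → k < length w / p → Scaled w (drop (k * p) w)
  to period k _ =
    proportional⇒scaled w (drop (k * p) w) |w|>0 (period⇒proportional-suffixes period k)

  from : (∀ k → k < length w / p → Scaled w (drop (k * p) w)) → FullAbelianPeriod w p
  from scaled = proportional-suffixes⇒period w p q |w|>0 |w|≡ suffix∝w
    where
    -- The last boundary i = 1 + q gives the empty suffix, which is trivially proportional.
    suffix∝w : ∀ i → i ≤ suc q → Proportional w (drop (i * p) w)
    suffix∝w i i≤ with m≤n⇒m<n∨m≡n i≤
    ... | inj₁ i<   = scaled⇒proportional w (drop (i * p) w) |w|>0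
                          (scaled i (subst (i <_) (sym #blocks) i<))
    ... | inj₂ refl = subst (Proportional w) (sym (drop-all (suc q * p) w (≤-reflexive |w|≡)))
                            (λ a → *-zeroʳ (length w))
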